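{- For an integer $k\geq 2$ and $n\geq0$ let $\theta_n=|H_k^{\nabla(2^n-1)}|$. Then $\theta_0=1$ and $\theta_1=k$, and moreover: (1) if $k=2$, then $\theta_{n+1}=2\theta_n$ for all $n\geq0$; (2) if $k=3$, then $\theta_{n+1}=3\theta_n$ for all $n\geq0$; (3) if $k=4$, then $\theta_{n+2}=2\theta_{n+1}+4\theta_n$ for all $n\geq0$; (4) if $k=5$, then $\theta_{n+2}=3\theta_{n+1}+6\theta_n$ for all $n\geq0$; (5) if $k=6$, then $\theta_{n+1}=5\theta_n$ for all $n\geq1$; (6) if $k=7$, then $\theta_{n+2}=6\theta_{n+1}+\theta_n$ for all $n\geq0$; (7) if $k=8$, then $\theta_2=48$ and $\theta_{n+3}=7\theta_{n+2}-2\theta_{n+1}-24\theta_n$ for all $n\geq0$.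
   Context: For nonempty finite sets $C=\{c_1,\ldots,c_s\}$ and $D=\{d_1,\ldots,d_t\}$ of positive integers, the symmetric product is $C\mathbin{\nabla}D=c_1D\mathbin{\triangle}c_2D\mathbin{\triangle}\cdots\mathbin{\triangle}c_sD$, where $c_iD=\{c_id_1,\ldots,c_id_t\}$ and $\triangle$ is symmetric difference (equivalently, the set of integers $m$ for which the number of pairs $(c,d)\in C\times D$ with $cd=m$ is odd). If $C$ or $D$ is empty, $C\mathbin{\nabla}D=\varnothing$. For a positive integer $k$ let $H_k=\{1,2,\ldots,k\}$, $H_k^{\nabla 0}=\{1\}$ and $H_k^{\nabla n}=H_k^{\nabla(n-1)}\mathbin{\nabla}H_k$ for $n\geq1$. -}

module Defs where

open import Data.Nat using (ℕ; zero; suc; _*_; _∸_; _^_; _≡ᵇ_)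
open import Data.Bool using (if_then_else_)
open import Data.List using (List; []; _∷_; foldr; map; length; upTo)

-- Finite sets of positive integers are represented as duplicate-free lists.
-- All operations below preserve duplicate-freeness, so 'length' is the cardinality.

toggle : ℕ → List ℕ → List ℕ
toggle x [] = x ∷ []
toggle x (y ∷ ys) = if x ≡ᵇ y then ys else y ∷ toggle x ys

_△_ : List ℕ → List ℕ → List ℕ
S △ T = foldr toggle S T

scale : ℕ → List ℕ → List ℕ
scale c D = map (c *_) D

_∇_ : List ℕ → List ℕ → List ℕ
C ∇ D = foldr (λ c acc → acc △ scale c D) [] C

H : ℕ → List ℕ
H k = map suc (upTo k)

H^∇ : ℕ → ℕ → List ℕ
H^∇ k zero = 1 ∷ []
H^∇ k (suc n) = H^∇ k n ∇ H k

θ : ℕ → ℕ → ℕ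
θ k n = length (H^∇ k (2 ^ n ∸ 1))

-- Modulo 2 the symmetric product is the multiplication of the group ring 𝔽₂[ℕ], in which
-- squaring is additive; hence H^∇(2ⁿ⁺¹ − 1) = H ∇ (H^∇(2ⁿ − 1))². So whenever Q ∇ H splits as a
-- disjoint union of scaled squares r·A_r² with pairwise distinct square classes r, the size of
-- Q ∇ H^∇(2ⁿ⁺¹ − 1) is Σ_r |A_r ∇ H^∇(2ⁿ − 1)|. Starting from Q = {1}, for k ≤ 8 only the sets
-- {1}, {2}, {1,2} and {1,4} arise, |{c} ∇ X| = |X|, and eliminating the auxiliary counts from
-- the resulting linear systems gives the recurrences. The splittings are checked by evaluation;
-- square classes are told apart by a prime dividing one scale exactly once and the other not at all.

module Submission where

open import Defs
open import Data.Bool using (Bool; true; false; _xor_; T; if_then_else_)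
open import Data.Bool.Properties using (xor-assoc; xor-comm; xor-same; xor-identityʳ)
open import Data.Empty using (⊥-elim)
open import Data.Integer using (+_) renaming (_+_ to _+ℤ_; _*_ to _*ℤ_; _-_ to _-ℤ_)
open import Data.Integer.Properties using (pos-+; pos-*)
import Data.Integer.Tactic.RingSolver as ℤ
open import Data.List using (List; []; _∷_; [_]; map; length; _++_; concatMap; upTo; foldr)
open import Data.List.Membership.Propositional.Properties using (∈-map⁻; ∈-++⁻)
open import Data.List.Properties using (length-map; length-++; length-upTo)
open import Data.List.Relation.Binary.Disjoint.Propositional using (Disjoint)
open import Data.List.Relation.Unary.All using (All; []; _∷_; all?)
import Data.List.Relation.Unary.All as All
import Data.List.Relation.Unary.All.Properties as All
open import Data.List.Relation.Unary.AllPairs using (AllPairs; allPairs?)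
import Data.List.Relation.Unary.AllPairs as AllPairs
import Data.List.Relation.Unary.AllPairs.Properties as AllPairs
open import Data.List.Relation.Unary.Any using (Any; here; there; any?)
open import Data.List.Relation.Unary.Unique.Propositional using (Unique; []; _∷_)
import Data.List.Relation.Unary.Unique.Propositional.Properties as Unique
open import Data.List.Relation.Unary.Unique.Propositional.Properties using (upTo⁺)
open import Data.Nat using (ℕ; zero; suc; _+_; _*_; _∸_; _^_; _<_; _≤_; _<?_; z<s; _≡ᵇ_; _<ᵇ_; NonZero)
open import Data.Nat.Base using (nonTrivial⇒n>1; >-nonZero; >-nonZero⁻¹)
open import Data.Nat.Divisibility using (_∣_; _∣?_; divides; module _∣_)
open _∣_ using (quotient; equality)
open import Data.Nat.Induction using (<-wellFounded)
open import Data.Nat.ListAction using (sum)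
open import Data.Nat.Primality using (Prime; prime; prime?; euclidsLemma; prime⇒nonZero)
open import Data.Nat.Properties
  using ( ≡ᵇ⇒≡; ≡⇒≡ᵇ; suc-injective; +-comm; +-assoc; +-suc; +-identityʳ; +-cancelʳ-≡
        ; *-comm; *-assoc; *-identityʳ; *-cancelˡ-≡; *-cancelʳ-≡; *-mono-<
        ; <-cmp; <⇒≢; >⇒≢; m<m*n; m*n≢0⇒m≢0; m^n>0 )
open import Data.Nat.Tactic.RingSolver using (solve-∀; solve)
open import Data.Product using (_×_; _,_; proj₁; proj₂; map₂)
open import Data.Sum using (_⊎_; inj₁; inj₂)
open import Data.Unit using (tt)
open import Function using (_∘_; _∋_)
open import Induction.WellFounded using (Acc; acc)
open import Level using (0ℓ)
open import Relation.Binary using (Setoid)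
open import Relation.Binary.Definitions using (tri<; tri≈; tri>)
open import Relation.Binary.PropositionalEquality hiding ([_])
import Relation.Binary.Reasoning.Setoid as SetoidReasoning
open import Relation.Nullary using (¬_; Dec; contradiction; ¬?; _×-dec_; _⊎-dec_)
open import Relation.Nullary.Decidable using (True; toWitness; from-yes)

xor-cancelˡ : ∀ a b → a xor (a xor b) ≡ b
xor-cancelˡ a b = trans (sym (xor-assoc a a b)) (cong (_xor b) (xor-same a))

xor-left-comm : ∀ a b c → a xor (b xor c) ≡ b xor (a xor c)
xor-left-comm false b c = refl
xor-left-comm true false c = refl
xor-left-comm true true c = refl

xor-interchange : ∀ a b c d → (a xor b) xor (c xor d) ≡ (a xor c) xor (b xor d)
xor-interchange a b c d = begin
  (a xor b) xor (c xor d)  ≡⟨ xor-assoc a b (c xor d) ⟩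
  a xor (b xor (c xor d))  ≡⟨ cong (a xor_) (xor-left-comm b c d) ⟩
  a xor (c xor (b xor d))  ≡⟨ xor-assoc a c (b xor d) ⟨
  (a xor c) xor (b xor d)  ∎
  where open ≡-Reasoning

parity : {A : Set} → (A → Bool) → List A → Bool
parity f []       = false
parity f (x ∷ xs) = f x xor parity f xs

private variable A B : Set

parity-cong : ∀ {f g : A → Bool} xs → (∀ x → f x ≡ g x) → parity f xs ≡ parity g xs
parity-cong []       f≗g = refl
parity-cong (x ∷ xs) f≗g = cong₂ _xor_ (f≗g x) (parity-cong xs f≗g)

parity-false : ∀ (xs : List A) → parity (λ _ → false) xs ≡ false
parity-false []       = refl
parity-false (x ∷ xs) = parity-false xs

parity-xor : ∀ (f g : A → Bool) xs → parity (λ x → f x xor g x) xs ≡ parity f xs xor parity g xs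
parity-xor f g []       = refl
parity-xor f g (x ∷ xs) = trans (cong ((f x xor g x) xor_) (parity-xor f g xs))
                                (xor-interchange (f x) (g x) (parity f xs) (parity g xs))

parity-++ : ∀ (f : A → Bool) xs ys → parity f (xs ++ ys) ≡ parity f xs xor parity f ys
parity-++ f []       ys = refl
parity-++ f (x ∷ xs) ys = trans (cong (f x xor_) (parity-++ f xs ys)) (sym (xor-assoc (f x) _ _))

parity-map : ∀ (f : B → Bool) (g : A → B) xs → parity f (map g xs) ≡ parity (λ x → f (g x)) xs
parity-map f g []       = refl
parity-map f g (x ∷ xs) = cong (f (g x) xor_) (parity-map f g xs)

parity-concatMap : ∀ (f : B → Bool) (g : A → List B) xs →
                   parity f (concatMap g xs) ≡ parity (λ x → parity f (g x)) xs
parity-concatMap f g []       = refl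
parity-concatMap f g (x ∷ xs) = trans (parity-++ f (g x) (concatMap g xs))
                                      (cong (parity f (g x) xor_) (parity-concatMap f g xs))

parity-swap : ∀ (F : A → B → Bool) xs ys →
              parity (λ x → parity (F x) ys) xs ≡ parity (λ y → parity (λ x → F x y) xs) ys
parity-swap F []       ys = sym (parity-false ys)
parity-swap F (x ∷ xs) ys = trans (cong (parity (F x) ys xor_) (parity-swap F xs ys))
                                  (sym (parity-xor (F x) (λ y → parity (λ x → F x y) xs) ys))

-- Off-diagonal terms of a symmetric double sum cancel in pairs.
parity-symmetric : ∀ (F : A → A → Bool) → (∀ x y → F x y ≡ F y x) → ∀ xs →
                   parity (λ x → parity (F x) xs) xs ≡ parity (λ x → F x x) xs
parity-symmetric F F-sym []       = refl
parity-symmetric F F-sym (x ∷ xs) = begin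
  (F x x xor parity (F x) xs) xor parity (λ y → F y x xor parity (F y) xs) xs
    ≡⟨ cong ((F x x xor parity (F x) xs) xor_) (parity-xor (λ y → F y x) (λ y → parity (F y) xs) xs) ⟩
  (F x x xor parity (F x) xs) xor (parity (λ y → F y x) xs xor parity (λ y → parity (F y) xs) xs)
    ≡⟨ cong (λ b → (F x x xor parity (F x) xs) xor (b xor _)) (parity-cong xs (λ y → F-sym y x)) ⟩
  (F x x xor parity (F x) xs) xor (parity (F x) xs xor parity (λ y → parity (F y) xs) xs)
    ≡⟨ xor-assoc (F x x) _ _ ⟩
  F x x xor (parity (F x) xs xor (parity (F x) xs xor parity (λ y → parity (F y) xs) xs))
    ≡⟨ cong (F x x xor_) (xor-cancelˡ (parity (F x) xs) _) ⟩
  F x x xor parity (λ y → parity (F y) xs) xs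
    ≡⟨ cong (F x x xor_) (parity-symmetric F F-sym xs) ⟩
  F x x xor parity (λ y → F y y) xs
    ∎
  where open ≡-Reasoning

≡ᵇ-true⇒≡ : ∀ m n → (m ≡ᵇ n) ≡ true → m ≡ n
≡ᵇ-true⇒≡ m n eq = ≡ᵇ⇒≡ m n (subst T (sym eq) tt)

≡ᵇ-false⇒≢ : ∀ m n → (m ≡ᵇ n) ≡ false → m ≢ n
≡ᵇ-false⇒≢ m n eq m≡n = subst T eq (≡⇒≡ᵇ m n m≡n)

≢⇒≡ᵇ-false : ∀ m n → m ≢ n → (m ≡ᵇ n) ≡ false
≢⇒≡ᵇ-false m n m≢n with m ≡ᵇ n in eq
... | true  = ⊥-elim (m≢n (≡ᵇ-true⇒≡ m n eq))
... | false = refl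

≡ᵇ-refl : ∀ m → (m ≡ᵇ m) ≡ true
≡ᵇ-refl zero    = refl
≡ᵇ-refl (suc m) = ≡ᵇ-refl m

parity-toggle : ∀ f x S → parity f (toggle x S) ≡ f x xor parity f S
parity-toggle f x []      = refl
parity-toggle f x (y ∷ S) with x ≡ᵇ y in eq
... | true  rewrite ≡ᵇ-true⇒≡ x y eq = sym (xor-cancelˡ (f y) (parity f S))
... | false = trans (cong (f y xor_) (parity-toggle f x S)) (xor-left-comm (f y) (f x) (parity f S))

parity-△ : ∀ f S T → parity f (S △ T) ≡ parity f S xor parity f T
parity-△ f S []      = sym (xor-identityʳ (parity f S))
parity-△ f S (t ∷ T) = begin
  parity f (toggle t (S △ T))          ≡⟨ parity-toggle f t (S △ T) ⟩
  f t xor parity f (S △ T)             ≡⟨ cong (f t xor_) (parity-△ f S T) ⟩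
  f t xor (parity f S xor parity f T)  ≡⟨ xor-left-comm (f t) (parity f S) (parity f T) ⟩
  parity f S xor (f t xor parity f T)  ∎
  where open ≡-Reasoning

parity-∇ : ∀ f C D → parity f (C ∇ D) ≡ parity (λ c → parity (λ d → f (c * d)) D) C
parity-∇ f []      D = refl
parity-∇ f (c ∷ C) D = begin
  parity f ((C ∇ D) △ scale c D)                                        ≡⟨ parity-△ f (C ∇ D) (scale c D) ⟩
  parity f (C ∇ D) xor parity f (map (c *_) D)  ≡⟨ cong₂ _xor_ (parity-∇ f C D) (parity-map f (c *_) D) ⟩
  rest xor parity (λ d → f (c * d)) D           ≡⟨ xor-comm rest _ ⟩
  parity (λ d → f (c * d)) D xor rest           ∎
  where
  open ≡-Reasoning
  rest = parity (λ c′ → parity (λ d → f (c′ * d)) D) C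

infix 4 _≃₂_

-- Equal multiplicities modulo 2, i.e. equality in the group ring 𝔽₂[ℕ].
record _≃₂_ (S T : List ℕ) : Set where
  constructor same-parities
  field parities : ∀ f → parity f S ≡ parity f T

open _≃₂_

≃₂-refl : ∀ {S} → S ≃₂ S
≃₂-refl = same-parities λ f → refl

≃₂-sym : ∀ {S T} → S ≃₂ T → T ≃₂ S
≃₂-sym S≃T = same-parities λ f → sym (parities S≃T f)

≃₂-trans : ∀ {S T U} → S ≃₂ T → T ≃₂ U → S ≃₂ U
≃₂-trans S≃T T≃U = same-parities λ f → trans (parities S≃T f) (parities T≃U f)

≃₂-setoid : Setoid 0ℓ 0ℓ
≃₂-setoid = record
  { Carrier       = List ℕ
  ; _≈_           = _≃₂_
  ; isEquivalence = record { refl = ≃₂-refl ; sym = ≃₂-sym ; trans = ≃₂-trans }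
  }

module ≃₂-Reasoning = SetoidReasoning ≃₂-setoid

squares : List ℕ → List ℕ
squares = map (λ u → u * u)

∇-cong : ∀ {C C′ D D′} → C ≃₂ C′ → D ≃₂ D′ → C ∇ D ≃₂ C′ ∇ D′
∇-cong {C} {C′} {D} {D′} C≃C′ D≃D′ = same-parities λ f → begin
  parity f (C ∇ D)                              ≡⟨ parity-∇ f C D ⟩
  parity (λ c → parity (λ d → f (c * d)) D) C   ≡⟨ parity-cong C (λ c → parities D≃D′ (λ d → f (c * d))) ⟩
  parity (λ c → parity (λ d → f (c * d)) D′) C  ≡⟨ parities C≃C′ (λ c → parity (λ d → f (c * d)) D′) ⟩
  parity (λ c → parity (λ d → f (c * d)) D′) C′ ≡⟨ parity-∇ f C′ D′ ⟨
  parity f (C′ ∇ D′)                            ∎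
  where open ≡-Reasoning

∇-congˡ : ∀ {C C′} D → C ≃₂ C′ → C ∇ D ≃₂ C′ ∇ D
∇-congˡ D C≃C′ = ∇-cong C≃C′ (≃₂-refl {D})

∇-congʳ : ∀ C {D D′} → D ≃₂ D′ → C ∇ D ≃₂ C ∇ D′
∇-congʳ C D≃D′ = ∇-cong (≃₂-refl {C}) D≃D′

∇-assoc : ∀ C D E → (C ∇ D) ∇ E ≃₂ C ∇ (D ∇ E)
∇-assoc C D E = same-parities λ f → begin
  parity f ((C ∇ D) ∇ E)
    ≡⟨ parity-∇ f (C ∇ D) E ⟩
  parity (λ x → parity (λ e → f (x * e)) E) (C ∇ D)
    ≡⟨ parity-∇ (λ x → parity (λ e → f (x * e)) E) C D ⟩
  parity (λ c → parity (λ d → parity (λ e → f (c * d * e)) E) D) C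
    ≡⟨ parity-cong C (λ c → parity-cong D (λ d → parity-cong E (λ e → cong f (*-assoc c d e)))) ⟩
  parity (λ c → parity (λ d → parity (λ e → f (c * (d * e))) E) D) C
    ≡⟨ parity-cong C (λ c → parity-∇ (λ y → f (c * y)) D E) ⟨
  parity (λ c → parity (λ y → f (c * y)) (D ∇ E)) C
    ≡⟨ parity-∇ f C (D ∇ E) ⟨
  parity f (C ∇ (D ∇ E))
    ∎
  where open ≡-Reasoning

∇-comm : ∀ C D → C ∇ D ≃₂ D ∇ C
∇-comm C D = same-parities λ f → begin
  parity f (C ∇ D)                             ≡⟨ parity-∇ f C D ⟩
  parity (λ c → parity (λ d → f (c * d)) D) C  ≡⟨ parity-swap (λ c d → f (c * d)) C D ⟩
  parity (λ d → parity (λ c → f (c * d)) C) D  ≡⟨ parity-cong D (λ d → parity-cong C (λ c → cong f (*-comm c d))) ⟩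
  parity (λ d → parity (λ c → f (d * c)) C) D  ≡⟨ parity-∇ f D C ⟨
  parity f (D ∇ C)                             ∎
  where open ≡-Reasoning

∇-identityʳ : ∀ C → C ∇ (1 ∷ []) ≃₂ C
∇-identityʳ C = same-parities λ f → trans (parity-∇ f C (1 ∷ []))
  (parity-cong C (λ c → trans (xor-identityʳ (f (c * 1))) (cong f (*-identityʳ c))))

∇-singletonˡ : ∀ c D → (c ∷ []) ∇ D ≃₂ map (c *_) D
∇-singletonˡ c D = same-parities λ f → trans (parity-∇ f (c ∷ []) D)
  (trans (xor-identityʳ (parity (λ d → f (c * d)) D)) (sym (parity-map f (c *_) D)))

∇-self : ∀ D → D ∇ D ≃₂ squares D
∇-self D = same-parities λ f → begin
  parity f (D ∇ D)                             ≡⟨ parity-∇ f D D ⟩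
  parity (λ c → parity (λ d → f (c * d)) D) D  ≡⟨ parity-symmetric (λ c d → f (c * d)) (λ c d → cong f (*-comm c d)) D ⟩
  parity (λ d → f (d * d)) D                   ≡⟨ parity-map f (λ u → u * u) D ⟨
  parity f (squares D)                         ∎
  where open ≡-Reasoning

module _ {P : ℕ → Set} where

  All-toggle : ∀ {x} S → P x → All P S → All P (toggle x S)
  All-toggle     []      px []         = px ∷ []
  All-toggle {x} (y ∷ S) px (py ∷ pS) with x ≡ᵇ y
  ... | true  = pS
  ... | false = py ∷ All-toggle S px pS

  All-△ : ∀ S T → All P S → All P T → All P (S △ T)
  All-△ S []      pS []        = pS
  All-△ S (t ∷ T) pS (pt ∷ pT) = All-toggle (S △ T) pt (All-△ S T pS pT)

  All-∇ : (∀ {a b} → P a → P b → P (a * b)) → ∀ C D → All P C → All P D → All P (C ∇ D)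
  All-∇ P-* []      D []        pD = []
  All-∇ P-* (c ∷ C) D (pc ∷ pC) pD =
    All-△ (C ∇ D) (scale c D) (All-∇ P-* C D pC pD) (All.map⁺ (All.map (P-* pc) pD))

Unique-toggle : ∀ x S → Unique S → Unique (toggle x S)
Unique-toggle x []      []        = [] ∷ []
Unique-toggle x (y ∷ S) (y∉S ∷ S!) with x ≡ᵇ y in eq
... | true  = S!
... | false = All-toggle S (λ y≡x → ≡ᵇ-false⇒≢ x y eq (sym y≡x)) y∉S ∷ Unique-toggle x S S!

Unique-△ : ∀ S T → Unique S → Unique (S △ T)
Unique-△ S []      S! = S!
Unique-△ S (t ∷ T) S! = Unique-toggle t (S △ T) (Unique-△ S T S!)

Unique-∇ : ∀ C D → Unique (C ∇ D)
Unique-∇ []      D = []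
Unique-∇ (c ∷ C) D = Unique-△ (C ∇ D) (scale c D) (Unique-∇ C D)

Unique-H^∇ : ∀ k m → Unique (H^∇ k m)
Unique-H^∇ k zero    = [] ∷ []
Unique-H^∇ k (suc m) = Unique-∇ (H^∇ k m) (H k)

occurs : ℕ → List ℕ → Bool
occurs m = parity (m ≡ᵇ_)

occurs-∉ : ∀ {x} S → All (x ≢_) S → occurs x S ≡ false
occurs-∉     []      []              = refl
occurs-∉ {x} (y ∷ S) (x≢y ∷ x∉S) rewrite ≢⇒≡ᵇ-false x y x≢y = occurs-∉ S x∉S

occurs-head : ∀ x S → All (x ≢_) S → occurs x (x ∷ S) ≡ true
occurs-head x S x∉S rewrite ≡ᵇ-refl x | occurs-∉ S x∉S = refl

length-toggle : ∀ x T → occurs x T ≡ true → length T ≡ suc (length (toggle x T))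
length-toggle x (y ∷ T) x∈T with x ≡ᵇ y
... | true  = refl
... | false = cong suc (length-toggle x T x∈T)

≃₂⇒length-≡ : ∀ {S T} → Unique S → Unique T → S ≃₂ T → length S ≡ length T
≃₂⇒length-≡ {[]}    {[]}    _ _ _ = refl
≃₂⇒length-≡ {[]}    {y ∷ T} _ (y∉T ∷ _) S≃T
  with () ← trans (parities S≃T (y ≡ᵇ_)) (occurs-head y T y∉T)
≃₂⇒length-≡ {x ∷ S} {T} (x∉S ∷ S!) T! S≃T =
  trans (cong suc (≃₂⇒length-≡ S! (Unique-toggle x T T!) S≃T′))
        (sym (length-toggle x T (trans (sym (parities S≃T (x ≡ᵇ_))) (occurs-head x S x∉S))))
  where
  S≃T′ : S ≃₂ toggle x T
  S≃T′ = same-parities λ f → trans (sym (xor-cancelˡ (f x) (parity f S)))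
    (trans (cong (f x xor_) (parities S≃T f)) (sym (parity-toggle f x T)))

length-singleton-∇ : ∀ {c} D → 0 < c → Unique D → length ((c ∷ []) ∇ D) ≡ length D
length-singleton-∇ {suc c} D _ D! =
  trans (≃₂⇒length-≡ (Unique-∇ (suc c ∷ []) D) (Unique.map⁺ (*-cancelˡ-≡ _ _ (suc c)) D!)
                     (∇-singletonˡ (suc c) D))
        (length-map (suc c *_) D)

Γ : ℕ → ℕ → List ℕ
Γ k n = H^∇ k (2 ^ n ∸ 1)

H^∇-+ : ∀ k a b → H^∇ k (b + a) ≃₂ H^∇ k a ∇ H^∇ k b
H^∇-+ k a zero    = ≃₂-sym (∇-identityʳ (H^∇ k a))
H^∇-+ k a (suc b) = begin
  H^∇ k (b + a) ∇ H k           ≈⟨ ∇-congˡ (H k) (H^∇-+ k a b) ⟩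
  (H^∇ k a ∇ H^∇ k b) ∇ H k     ≈⟨ ∇-assoc (H^∇ k a) (H^∇ k b) (H k) ⟩
  H^∇ k a ∇ (H^∇ k b ∇ H k)     ∎
  where open ≃₂-Reasoning

2*p∸1 : ∀ p → 0 < p → 2 * p ∸ 1 ≡ suc ((p ∸ 1) + (p ∸ 1))
2*p∸1 (suc q) _ = trans (+-suc q (q + 0)) (cong (λ x → suc (q + x)) (+-identityʳ q))

Γ-suc : ∀ k n → Γ k (suc n) ≃₂ H k ∇ squares (Γ k n)
Γ-suc k n = begin
  H^∇ k (2 * 2 ^ n ∸ 1)        ≡⟨ cong (H^∇ k) (2*p∸1 (2 ^ n) (m^n>0 2 n)) ⟩
  H^∇ k (m + m) ∇ H k          ≈⟨ ∇-congˡ (H k) (H^∇-+ k m m) ⟩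
  (Γ k n ∇ Γ k n) ∇ H k        ≈⟨ ∇-congˡ (H k) (∇-self (Γ k n)) ⟩
  squares (Γ k n) ∇ H k        ≈⟨ ∇-comm (squares (Γ k n)) (H k) ⟩
  H k ∇ squares (Γ k n)        ∎
  where
  open ≃₂-Reasoning
  m = 2 ^ n ∸ 1

Block : Set
Block = ℕ × List ℕ

scaledSquares : Block → List ℕ
scaledSquares (r , A) = map (λ a → r * (a * a)) A

⟦_⟧ : List Block → List ℕ
⟦ bs ⟧ = concatMap scaledSquares bs

∇-blocks : List Block → List ℕ → List Block
∇-blocks bs G = map (map₂ (_∇ G)) bs

scaledSquares-∇-squares : ∀ b G → scaledSquares b ∇ squares G ≃₂ scaledSquares (map₂ (_∇ G) b)
scaledSquares-∇-squares (r , A) G = same-parities λ f → begin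
  parity f (scaledSquares (r , A) ∇ squares G)
    ≡⟨ parity-∇ f (scaledSquares (r , A)) (squares G) ⟩
  parity (λ x → parity (λ y → f (x * y)) (squares G)) (scaledSquares (r , A))
    ≡⟨ parity-map _ (λ a → r * (a * a)) A ⟩
  parity (λ a → parity (λ y → f (r * (a * a) * y)) (squares G)) A
    ≡⟨ parity-cong A (λ a → parity-map _ (λ u → u * u) G) ⟩
  parity (λ a → parity (λ g → f (r * (a * a) * (g * g))) G) A
    ≡⟨ parity-cong A (λ a → parity-cong G (λ g → cong f (square-product r a g))) ⟩
  parity (λ a → parity (λ g → f (r * ((a * g) * (a * g)))) G) A
    ≡⟨ parity-∇ (λ y → f (r * (y * y))) A G ⟨
  parity (λ y → f (r * (y * y))) (A ∇ G)
    ≡⟨ parity-map f (λ y → r * (y * y)) (A ∇ G) ⟨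
  parity f (scaledSquares (r , A ∇ G))
    ∎
  where
  open ≡-Reasoning
  square-product : ∀ r a g → r * (a * a) * (g * g) ≡ r * ((a * g) * (a * g))
  square-product = solve-∀

⟦⟧-∇-squares : ∀ bs G → ⟦ bs ⟧ ∇ squares G ≃₂ ⟦ ∇-blocks bs G ⟧
⟦⟧-∇-squares bs G = same-parities λ f → begin
  parity f (⟦ bs ⟧ ∇ squares G)
    ≡⟨ parity-∇ f ⟦ bs ⟧ (squares G) ⟩
  parity (λ x → parity (λ y → f (x * y)) (squares G)) ⟦ bs ⟧
    ≡⟨ parity-concatMap _ scaledSquares bs ⟩
  parity (λ b → parity (λ x → parity (λ y → f (x * y)) (squares G)) (scaledSquares b)) bs
    ≡⟨ parity-cong bs (λ b → trans (sym (parity-∇ f (scaledSquares b) (squares G)))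
                                   (parities (scaledSquares-∇-squares b G) f)) ⟩
  parity (λ b → parity f (scaledSquares (map₂ (_∇ G) b))) bs
    ≡⟨ parity-map _ (map₂ (_∇ G)) bs ⟨
  parity (λ b → parity f (scaledSquares b)) (∇-blocks bs G)
    ≡⟨ parity-concatMap f scaledSquares (∇-blocks bs G) ⟨
  parity f ⟦ ∇-blocks bs G ⟧
    ∎
  where open ≡-Reasoning

DisjointSquareClasses : ℕ → ℕ → Set
DisjointSquareClasses r r′ = ∀ {t s} → 0 < t → 0 < s → r * (t * t) ≢ r′ * (s * s)

PositiveBlock : Block → Set
PositiveBlock (r , A) = 0 < r × All (0 <_) A

Separated : Block → Block → Set
Separated b b′ = DisjointSquareClasses (proj₁ b) (proj₁ b′)

square-injective : ∀ {t s} → t * t ≡ s * s → t ≡ s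
square-injective {t} {s} eq with <-cmp t s
... | tri< t<s _ _ = contradiction eq (<⇒≢ (*-mono-< t<s t<s))
... | tri≈ _ t≡s _ = t≡s
... | tri> _ _ s<t = contradiction eq (>⇒≢ (*-mono-< s<t s<t))

Unique-scaledSquares : ∀ {r A} → 0 < r → Unique A → Unique (scaledSquares (r , A))
Unique-scaledSquares {suc r} _ = Unique.map⁺ (λ eq → square-injective (*-cancelˡ-≡ _ _ (suc r) eq))

scaledSquares-disjoint : ∀ {b b′} → PositiveBlock b → PositiveBlock b′ → Separated b b′ →
                         Disjoint (scaledSquares b) (scaledSquares b′)
scaledSquares-disjoint (_ , A⁺) (_ , A′⁺) sep (v∈ , v∈′)
  with ∈-map⁻ _ v∈ | ∈-map⁻ _ v∈′
... | t , t∈A , refl | s , s∈A′ , eq = sep (All.lookup A⁺ t∈A) (All.lookup A′⁺ s∈A′) eq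

scaledSquares-disjoint-⟦⟧ : ∀ {b} bs → PositiveBlock b → All PositiveBlock bs → All (Separated b) bs →
                            Disjoint (scaledSquares b) ⟦ bs ⟧
scaledSquares-disjoint-⟦⟧ (b′ ∷ bs) b⁺ (b′⁺ ∷ bs⁺) (sep ∷ seps) (v∈ , v∈⟦b′∷bs⟧)
  with ∈-++⁻ (scaledSquares b′) v∈⟦b′∷bs⟧
... | inj₁ v∈b′ = scaledSquares-disjoint b⁺ b′⁺ sep (v∈ , v∈b′)
... | inj₂ v∈bs = scaledSquares-disjoint-⟦⟧ bs b⁺ bs⁺ seps (v∈ , v∈bs)

Unique-⟦⟧ : ∀ bs → All PositiveBlock bs → All (Unique ∘ proj₂) bs → AllPairs Separated bs → Unique ⟦ bs ⟧
Unique-⟦⟧ []       _           _         _             = []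
Unique-⟦⟧ (b ∷ bs) (b⁺ ∷ bs⁺) (A! ∷ bs!) (seps ∷ bs-sep) =
  Unique.++⁺ (Unique-scaledSquares (proj₁ b⁺) A!) (Unique-⟦⟧ bs bs⁺ bs! bs-sep)
             (scaledSquares-disjoint-⟦⟧ bs b⁺ bs⁺ seps)

length-⟦∇-blocks⟧ : ∀ bs G → length ⟦ ∇-blocks bs G ⟧ ≡ sum (map (λ b → length (proj₂ b ∇ G)) bs)
length-⟦∇-blocks⟧ []             G = refl
length-⟦∇-blocks⟧ ((r , A) ∷ bs) G = begin
  length (scaledSquares (r , A ∇ G) ++ ⟦ ∇-blocks bs G ⟧)
    ≡⟨ length-++ (scaledSquares (r , A ∇ G)) ⟩
  length (scaledSquares (r , A ∇ G)) + length ⟦ ∇-blocks bs G ⟧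
    ≡⟨ cong₂ _+_ (length-map _ (A ∇ G)) (length-⟦∇-blocks⟧ bs G) ⟩
  length (A ∇ G) + sum (map (λ b → length (proj₂ b ∇ G)) bs)
    ∎
  where open ≡-Reasoning

positive-H : ∀ k → All (0 <_) (H k)
positive-H k = All.map⁺ (All.universal (λ _ → z<s) (upTo k))

positive-H^∇ : ∀ k m → All (0 <_) (H^∇ k m)
positive-H^∇ k zero    = z<s ∷ []
positive-H^∇ k (suc m) = All-∇ *-mono-< (H^∇ k m) (H k) (positive-H^∇ k m) (positive-H k)

N : ℕ → List ℕ → ℕ → ℕ
N k Q n = length (Q ∇ Γ k n)

transition : ∀ k Q bs → Q ∇ H k ≃₂ ⟦ bs ⟧ → All PositiveBlock bs → AllPairs Separated bs →
             ∀ n → N k Q (suc n) ≡ sum (map (λ b → N k (proj₂ b) n) bs)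
transition k Q bs Q∇H≃⟦bs⟧ bs⁺ bs-sep n =
  trans (≃₂⇒length-≡ (Unique-∇ Q (Γ k (suc n))) (Unique-⟦⟧ bs′ bs′⁺ bs′! (AllPairs.map⁺ bs-sep))
                     decomposition)
        (length-⟦∇-blocks⟧ bs (Γ k n))
  where
  bs′ = ∇-blocks bs (Γ k n)
  bs′⁺ : All PositiveBlock bs′
  bs′⁺ = All.map⁺ (All.map (λ { {r , A} (r⁺ , A⁺) →
    r⁺ , All-∇ *-mono-< A (Γ k n) A⁺ (positive-H^∇ k (2 ^ n ∸ 1)) }) bs⁺)
  bs′! : All (Unique ∘ proj₂) bs′
  bs′! = All.map⁺ (All.universal (λ b → Unique-∇ (proj₂ b) (Γ k n)) bs)
  decomposition : Q ∇ Γ k (suc n) ≃₂ ⟦ bs′ ⟧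
  decomposition = begin
    Q ∇ Γ k (suc n)               ≈⟨ ∇-congʳ Q (Γ-suc k n) ⟩
    Q ∇ (H k ∇ squares (Γ k n))   ≈⟨ ∇-assoc Q (H k) (squares (Γ k n)) ⟨
    (Q ∇ H k) ∇ squares (Γ k n)   ≈⟨ ∇-congˡ (squares (Γ k n)) Q∇H≃⟦bs⟧ ⟩
    ⟦ bs ⟧ ∇ squares (Γ k n)      ≈⟨ ⟦⟧-∇-squares bs (Γ k n) ⟩
    ⟦ bs′ ⟧                       ∎
    where open ≃₂-Reasoning

∣-square : ∀ {p m} → Prime p → p ∣ m * m → p ∣ m
∣-square {m = m} p-prime p∣m² with euclidsLemma m m p-prime p∣m²
... | inj₁ p∣m = p∣m
... | inj₂ p∣m = p∣m

∣-times-square : ∀ {p w m} → Prime p → ¬ p ∣ w → p ∣ w * (m * m) → p ∣ m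
∣-times-square {w = w} {m} p-prime p∤w p∣wm² with euclidsLemma w (m * m) p-prime p∣wm²
... | inj₁ p∣w  = contradiction p∣w p∤w
... | inj₂ p∣m² = ∣-square p-prime p∣m²

-- Infinite descent: p divides s, hence t, and dividing out p² reproduces the equation for t / p.
p*u*t²≢w*s² : ∀ {p u w} → Prime p → ¬ p ∣ u → ¬ p ∣ w → ∀ {t s} → 0 < t → p * u * (t * t) ≢ w * (s * s)
p*u*t²≢w*s² {p} {u} {w} p-prime@(prime _) p∤u p∤w {t} {s} = descend t (<-wellFounded t) {s}
  where
  instance
    p≢0 : NonZero p
    p≢0 = prime⇒nonZero p-prime

  [p*u]*x≡u*x*p : ∀ p u x → p * u * x ≡ u * x * p
  [p*u]*x≡u*x*p = solve-∀
  w*[cp]²≡w*c²*p*p : ∀ w c p → w * ((c * p) * (c * p)) ≡ w * (c * c) * p * p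
  w*[cp]²≡w*c²*p*p = solve-∀
  p*u*d²*p≡u*[dp]² : ∀ p u d → p * u * (d * d) * p ≡ u * ((d * p) * (d * p))
  p*u*d²*p≡u*[dp]² = solve-∀

  descend : ∀ t → Acc _<_ t → ∀ {s} → 0 < t → p * u * (t * t) ≢ w * (s * s)
  descend t (acc smaller) {s} t>0 eq = descend d (smaller d<t) {c} (>-nonZero⁻¹ d) p*u*d²≡w*c²
    where
    open ≡-Reasoning
    p∣s : p ∣ s
    p∣s = ∣-times-square {m = s} p-prime p∤w (divides (u * (t * t)) (begin
      w * (s * s)        ≡⟨ eq ⟨
      p * u * (t * t)    ≡⟨ [p*u]*x≡u*x*p p u (t * t) ⟩
      u * (t * t) * p    ∎))
    c = quotient p∣s
    u*t²≡w*c²*p : u * (t * t) ≡ w * (c * c) * p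
    u*t²≡w*c²*p = *-cancelʳ-≡ _ _ p (begin
      u * (t * t) * p            ≡⟨ [p*u]*x≡u*x*p p u (t * t) ⟨
      p * u * (t * t)            ≡⟨ eq ⟩
      w * (s * s)                ≡⟨ cong (λ x → w * (x * x)) (equality p∣s) ⟩
      w * ((c * p) * (c * p))    ≡⟨ w*[cp]²≡w*c²*p*p w c p ⟩
      w * (c * c) * p * p        ∎)
    p∣t : p ∣ t
    p∣t = ∣-times-square {m = t} p-prime p∤u (divides (w * (c * c)) u*t²≡w*c²*p)
    d = quotient p∣t
    instance
      d≢0 : NonZero d
      d≢0 = m*n≢0⇒m≢0 d {{>-nonZero (subst (0 <_) (equality p∣t) t>0)}}
    d<t : d < t
    d<t = subst (d <_) (sym (equality p∣t)) (m<m*n d p (nonTrivial⇒n>1 p))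
    p*u*d²≡w*c² : p * u * (d * d) ≡ w * (c * c)
    p*u*d²≡w*c² = *-cancelʳ-≡ _ _ p (begin
      p * u * (d * d) * p        ≡⟨ p*u*d²*p≡u*[dp]² p u d ⟩
      u * ((d * p) * (d * p))    ≡⟨ cong (λ x → u * (x * x)) (equality p∣t) ⟨
      u * (t * t)                ≡⟨ u*t²≡w*c²*p ⟩
      w * (c * c) * p            ∎)

DisjointSquareClasses-sym : ∀ {r r′} → DisjointSquareClasses r r′ → DisjointSquareClasses r′ r
DisjointSquareClasses-sym disjoint t>0 s>0 eq = disjoint s>0 t>0 (sym eq)

-- p divides r to an odd power (namely once) and r′ to an even power (namely zero).
SeparatedBy : ℕ → ℕ → ℕ → Set
SeparatedBy p r r′ = p ∣ r × ¬ (p * p ∣ r) × ¬ (p ∣ r′)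

separatedBy? : ∀ p r r′ → Dec (SeparatedBy p r r′)
separatedBy? p r r′ = p ∣? r ×-dec ¬? (p * p ∣? r) ×-dec ¬? (p ∣? r′)

separatedBy⇒disjoint : ∀ {p r r′} → Prime p → SeparatedBy p r r′ → DisjointSquareClasses r r′
separatedBy⇒disjoint {p} {r} {r′} p-prime (divides q r≡q*p , p²∤r , p∤r′) {t} {s} t>0 _ eq =
  p*u*t²≢w*s² p-prime p∤q p∤r′ {t} {s} t>0 (trans (cong (_* (t * t)) (trans (*-comm p q) (sym r≡q*p))) eq)
  where
  p∤q : ¬ p ∣ q
  p∤q (divides e q≡e*p) = p²∤r (divides e (trans r≡q*p (trans (cong (_* p) q≡e*p) (*-assoc e p p))))

SeparatedByOneOf : List ℕ → Block → Block → Set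
SeparatedByOneOf ps b b′ =
  Any (λ p → SeparatedBy p (proj₁ b) (proj₁ b′) ⊎ SeparatedBy p (proj₁ b′) (proj₁ b)) ps

separatedByOneOf? : ∀ ps b b′ → Dec (SeparatedByOneOf ps b b′)
separatedByOneOf? ps b b′ =
  any? (λ p → separatedBy? p (proj₁ b) (proj₁ b′) ⊎-dec separatedBy? p (proj₁ b′) (proj₁ b)) ps

separatedByOneOf⇒separated : ∀ {ps} → All Prime ps → ∀ {b b′} → SeparatedByOneOf ps b b′ → Separated b b′
separatedByOneOf⇒separated (p-prime ∷ _) {r , _} {r′ , _} (here (inj₁ sep)) =
  separatedBy⇒disjoint {r = r} {r′} p-prime sep
separatedByOneOf⇒separated (p-prime ∷ _) {r , _} {r′ , _} (here (inj₂ sep)) =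
  DisjointSquareClasses-sym {r′} {r} (separatedBy⇒disjoint p-prime sep)
separatedByOneOf⇒separated (_ ∷ ps-prime) {b} {b′} (there sep) =
  separatedByOneOf⇒separated ps-prime {b} {b′} sep

positiveBlock? : ∀ b → Dec (PositiveBlock b)
positiveBlock? (r , A) = 0 <? r ×-dec all? (0 <?_) A

-- Sorted insertion that cancels a repeated element, so that normalise S is the sorted list of
-- the elements of odd multiplicity in S: a canonical representative of its ≃₂-class.
insert₂ : ℕ → List ℕ → List ℕ
insert₂ x []       = x ∷ []
insert₂ x (y ∷ ys) = if x <ᵇ y then x ∷ y ∷ ys else (if x ≡ᵇ y then ys else y ∷ insert₂ x ys)

normalise : List ℕ → List ℕ
normalise = foldr insert₂ []

parity-insert₂ : ∀ f x S → parity f (insert₂ x S) ≡ f x xor parity f S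
parity-insert₂ f x []      = refl
parity-insert₂ f x (y ∷ S) with x <ᵇ y
... | true  = refl
... | false with x ≡ᵇ y in eq
...   | true  rewrite ≡ᵇ-true⇒≡ x y eq = sym (xor-cancelˡ (f y) (parity f S))
...   | false = trans (cong (f y xor_) (parity-insert₂ f x S)) (xor-left-comm (f y) (f x) (parity f S))

normalise-≃₂ : ∀ S → normalise S ≃₂ S
normalise-≃₂ S = same-parities (go S)
  where
  go : ∀ S f → parity f (normalise S) ≡ parity f S
  go []      f = refl
  go (x ∷ S) f = trans (parity-insert₂ f x (normalise S)) (cong (f x xor_) (go S f))

normalise-≡⇒≃₂ : ∀ S T → normalise S ≡ normalise T → S ≃₂ T
normalise-≡⇒≃₂ S T eq = begin
  S              ≈⟨ normalise-≃₂ S ⟨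
  normalise S    ≡⟨ eq ⟩
  normalise T    ≈⟨ normalise-≃₂ T ⟩
  T              ∎
  where open ≃₂-Reasoning

-- They separate the square-free scales up to 14 that occur in the splittings below.
smallPrimes : List ℕ
smallPrimes = 2 ∷ 3 ∷ 5 ∷ 7 ∷ []

transition-by-computation :
  ∀ k Q bs → normalise (Q ∇ H k) ≡ normalise ⟦ bs ⟧ →
  {True (all? positiveBlock? bs)} → {True (allPairs? (separatedByOneOf? smallPrimes) bs)} →
  ∀ n → N k Q (suc n) ≡ sum (map (λ b → N k (proj₂ b) n) bs)
transition-by-computation k Q bs eq {bs⁺} {bs-sep} =
  transition k Q bs (normalise-≡⇒≃₂ (Q ∇ H k) ⟦ bs ⟧ eq) (toWitness bs⁺)
    (AllPairs.map (λ {b} {b′} → separatedByOneOf⇒separated smallPrimes-prime {b} {b′}) (toWitness bs-sep))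
  where
  smallPrimes-prime : All Prime smallPrimes
  smallPrimes-prime = from-yes (all? prime? smallPrimes)

N-singleton : ∀ k {c} n → 0 < c → N k [ c ] n ≡ θ k n
N-singleton k n c>0 = length-singleton-∇ (Γ k n) c>0 (Unique-H^∇ k (2 ^ n ∸ 1))

θ≡N[1] : ∀ k n → θ k n ≡ N k [ 1 ] n
θ≡N[1] k n = sym (N-singleton k {1} n z<s)

N[c]≡N[1] : ∀ k {c} n → 0 < c → N k [ c ] n ≡ N k [ 1 ] n
N[c]≡N[1] k n c>0 = trans (N-singleton k n c>0) (θ≡N[1] k n)

θ-at-1 : ∀ k → θ k 1 ≡ k
θ-at-1 k = trans (length-singleton-∇ {1} (H k) z<s (Unique.map⁺ suc-injective (upTo⁺ k)))
              (trans (length-map suc (upTo k)) (length-upTo k))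

-- c is a count equal to, but not definitionally, a (N k [ 2 ] versus N k [ 1 ]).
second-order-recurrence : ∀ (a b c : ℕ → ℕ) α γ → (∀ n → c n ≡ a n) →
  (∀ n → a (suc n) ≡ b n + α * a n) → (∀ n → b (suc n) ≡ c n + γ * a n) →
  ∀ n → a (suc (suc n)) ≡ α * a (suc n) + suc γ * a n
second-order-recurrence a b c α γ c≗a a-step b-step n = begin
  a (suc (suc n))                     ≡⟨ a-step (suc n) ⟩
  b (suc n) + α * a (suc n)           ≡⟨ cong (_+ α * a (suc n)) (b-step n) ⟩
  (c n + γ * a n) + α * a (suc n)     ≡⟨ cong (λ x → (x + γ * a n) + α * a (suc n)) (c≗a n) ⟩
  suc γ * a n + α * a (suc n)         ≡⟨ +-comm (suc γ * a n) (α * a (suc n)) ⟩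
  α * a (suc n) + suc γ * a n         ∎
  where open ≡-Reasoning

second-order-recurrence′ : ∀ (a b c : ℕ → ℕ) α γ → (∀ n → c n ≡ a n) →
  (∀ n → a (suc n) ≡ b n + α * a n) → (∀ n → b (suc n) ≡ b n + (c n + γ * a n)) →
  ∀ n → a (suc (suc n)) + α * a n ≡ suc α * a (suc n) + suc γ * a n
second-order-recurrence′ a b c α γ c≗a a-step b-step n = begin
  a (suc (suc n)) + α * a n
    ≡⟨ cong (_+ α * a n) (trans (a-step (suc n)) (cong (_+ α * a (suc n)) (b-step n))) ⟩
  (b n + (c n + γ * a n)) + α * a (suc n) + α * a n
    ≡⟨ cong (λ x → (b n + (x + γ * a n)) + α * a (suc n) + α * a n) (c≗a n) ⟩
  (b n + suc γ * a n) + α * a (suc n) + α * a n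
    ≡⟨ exchange (b n) (suc γ * a n) (α * a (suc n)) (α * a n) ⟩
  (b n + α * a n) + α * a (suc n) + suc γ * a n
    ≡⟨ cong (λ x → x + α * a (suc n) + suc γ * a n) (a-step n) ⟨
  suc α * a (suc n) + suc γ * a n
    ∎
  where
  open ≡-Reasoning
  exchange : ∀ x y z w → (x + y) + z + w ≡ (x + w) + z + y
  exchange = solve-∀

-- Cayley–Hamilton for the transfer matrix ((4,2,0),(4,1,1),(0,4,2)) of (a , b , d),
-- whose characteristic polynomial is λ³ − 7λ² + 2λ + 24.
third-order-recurrence : ∀ (a b d : ℕ → ℕ) →
  (∀ n → a (suc n) ≡ b n + (b n + 4 * a n)) → (∀ n → b (suc n) ≡ d n + (b n + 4 * a n)) →
  (∀ n → d (suc n) ≡ d n + (d n + 4 * b n)) →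
  ∀ n → a (3 + n) + (2 * a (1 + n) + 24 * a n) ≡ 7 * a (2 + n)
third-order-recurrence a b d a-step b-step d-step n
  rewrite a-step (2 + n) | b-step (1 + n) | a-step (1 + n) | d-step n | b-step n | a-step n
  with a n | b n | d n
... | x | y | z = solve (List ℕ ∋ x ∷ y ∷ z ∷ [])

x+2y+24w≡7z⇒x≡7z-2y-24w : ∀ x y z w → x + (2 * y + 24 * w) ≡ 7 * z →
          + x ≡ ((+ 7) *ℤ (+ z) -ℤ (+ 2) *ℤ (+ y)) -ℤ (+ 24) *ℤ (+ w)
x+2y+24w≡7z⇒x≡7z-2y-24w x y z w eq = begin
  + x                                                  ≡⟨ rearrange (+ x) (+ y) (+ w) ⟩
  ((+ x +ℤ ((+ 2) *ℤ (+ y) +ℤ (+ 24) *ℤ (+ w))) -ℤ (+ 2) *ℤ (+ y)) -ℤ (+ 24) *ℤ (+ w)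
                                                       ≡⟨ cong (λ v → (v -ℤ (+ 2) *ℤ (+ y)) -ℤ (+ 24) *ℤ (+ w)) lifted ⟩
  ((+ 7) *ℤ (+ z) -ℤ (+ 2) *ℤ (+ y)) -ℤ (+ 24) *ℤ (+ w) ∎
  where
  open ≡-Reasoning
  rearrange : ∀ x y w → x ≡ ((x +ℤ ((+ 2) *ℤ y +ℤ (+ 24) *ℤ w)) -ℤ (+ 2) *ℤ y) -ℤ (+ 24) *ℤ w
  rearrange = ℤ.solve-∀
  lifted : + x +ℤ ((+ 2) *ℤ (+ y) +ℤ (+ 24) *ℤ (+ w)) ≡ (+ 7) *ℤ (+ z)
  lifted = begin
    + x +ℤ ((+ 2) *ℤ (+ y) +ℤ (+ 24) *ℤ (+ w))  ≡⟨ cong (λ v → + x +ℤ (v +ℤ (+ 24) *ℤ (+ w))) (pos-* 2 y) ⟨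
    + x +ℤ (+ (2 * y) +ℤ (+ 24) *ℤ (+ w))      ≡⟨ cong (λ v → + x +ℤ (+ (2 * y) +ℤ v)) (pos-* 24 w) ⟨
    + x +ℤ (+ (2 * y) +ℤ + (24 * w))           ≡⟨ cong (+ x +ℤ_) (pos-+ (2 * y) (24 * w)) ⟨
    + x +ℤ + (2 * y + 24 * w)                  ≡⟨ pos-+ x (2 * y + 24 * w) ⟨
    + (x + (2 * y + 24 * w))                   ≡⟨ cong +_ eq ⟩
    + (7 * z)                                  ≡⟨ pos-* 7 z ⟩
    (+ 7) *ℤ (+ z)                             ∎

θ₂-recurrence : ∀ n → θ 2 (suc n) ≡ 2 * θ 2 n
θ₂-recurrence n rewrite θ≡N[1] 2 (suc n) | θ≡N[1] 2 n =
  transition-by-computation 2 [ 1 ] ((1 , [ 1 ]) ∷ (2 , [ 1 ]) ∷ []) refl n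

θ₃-recurrence : ∀ n → θ 3 (suc n) ≡ 3 * θ 3 n
θ₃-recurrence n rewrite θ≡N[1] 3 (suc n) | θ≡N[1] 3 n =
  transition-by-computation 3 [ 1 ] ((1 , [ 1 ]) ∷ (2 , [ 1 ]) ∷ (3 , [ 1 ]) ∷ []) refl n

θ₄-recurrence : ∀ n → θ 4 (n + 2) ≡ 2 * θ 4 (n + 1) + 4 * θ 4 n
θ₄-recurrence n rewrite θ≡N[1] 4 (n + 2) | θ≡N[1] 4 (n + 1) | θ≡N[1] 4 n | +-comm n 2 | +-comm n 1 =
  second-order-recurrence (N 4 [ 1 ]) (N 4 (1 ∷ 2 ∷ [])) (N 4 [ 2 ]) 2 3 (λ j → N[c]≡N[1] 4 {2} j z<s)
    (transition-by-computation 4 [ 1 ]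
      ((1 , 1 ∷ 2 ∷ []) ∷ (2 , [ 1 ]) ∷ (3 , [ 1 ]) ∷ []) refl)
    (transition-by-computation 4 (1 ∷ 2 ∷ [])
      ((2 , [ 2 ]) ∷ (1 , [ 1 ]) ∷ (3 , [ 1 ]) ∷ (6 , [ 1 ]) ∷ []) refl)
    n

θ₅-recurrence : ∀ n → θ 5 (n + 2) ≡ 3 * θ 5 (n + 1) + 6 * θ 5 n
θ₅-recurrence n rewrite θ≡N[1] 5 (n + 2) | θ≡N[1] 5 (n + 1) | θ≡N[1] 5 n | +-comm n 2 | +-comm n 1 =
  second-order-recurrence (N 5 [ 1 ]) (N 5 (1 ∷ 2 ∷ [])) (N 5 [ 2 ]) 3 5 (λ j → N[c]≡N[1] 5 {2} j z<s)
    (transition-by-computation 5 [ 1 ]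
      ((1 , 1 ∷ 2 ∷ []) ∷ (2 , [ 1 ]) ∷ (3 , [ 1 ]) ∷ (5 , [ 1 ]) ∷ []) refl)
    (transition-by-computation 5 (1 ∷ 2 ∷ [])
      ((2 , [ 2 ]) ∷ (1 , [ 1 ]) ∷ (3 , [ 1 ]) ∷ (5 , [ 1 ]) ∷ (6 , [ 1 ]) ∷ (10 , [ 1 ]) ∷ []) refl)
    n

θ₆-recurrence : ∀ n → 1 ≤ n → θ 6 (n + 1) ≡ 5 * θ 6 n
θ₆-recurrence (suc m) _ rewrite θ≡N[1] 6 (suc m + 1) | θ≡N[1] 6 (suc m) | +-comm m 1 =
  +-cancelʳ-≡ (4 * N 6 [ 1 ] m) _ _
    (second-order-recurrence′ (N 6 [ 1 ]) (N 6 (1 ∷ 2 ∷ [])) (N 6 [ 2 ]) 4 3 (λ j → N[c]≡N[1] 6 {2} j z<s)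
      (transition-by-computation 6 [ 1 ]
        ((1 , 1 ∷ 2 ∷ []) ∷ (2 , [ 1 ]) ∷ (3 , [ 1 ]) ∷ (5 , [ 1 ]) ∷ (6 , [ 1 ]) ∷ []) refl)
      (transition-by-computation 6 (1 ∷ 2 ∷ [])
        ((3 , 1 ∷ 2 ∷ []) ∷ (2 , [ 2 ]) ∷ (1 , [ 1 ]) ∷ (5 , [ 1 ]) ∷ (10 , [ 1 ]) ∷ []) refl)
      m)

θ₇-recurrence : ∀ n → θ 7 (n + 2) ≡ 6 * θ 7 (n + 1) + θ 7 n
θ₇-recurrence n rewrite θ≡N[1] 7 (n + 2) | θ≡N[1] 7 (n + 1) | θ≡N[1] 7 n | +-comm n 2 | +-comm n 1 =
  +-cancelʳ-≡ (5 * N 7 [ 1 ] n) _ _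
    (trans (second-order-recurrence′ (N 7 [ 1 ]) (N 7 (1 ∷ 2 ∷ [])) (N 7 [ 2 ]) 5 5 (λ j → N[c]≡N[1] 7 {2} j z<s)
      (transition-by-computation 7 [ 1 ]
        ((1 , 1 ∷ 2 ∷ []) ∷ (2 , [ 1 ]) ∷ (3 , [ 1 ]) ∷ (5 , [ 1 ]) ∷ (6 , [ 1 ]) ∷ (7 , [ 1 ]) ∷ []) refl)
      (transition-by-computation 7 (1 ∷ 2 ∷ [])
        ((3 , 1 ∷ 2 ∷ []) ∷ (2 , [ 2 ]) ∷ (1 , [ 1 ]) ∷ (5 , [ 1 ]) ∷ (7 , [ 1 ]) ∷
         (10 , [ 1 ]) ∷ (14 , [ 1 ]) ∷ []) refl)
      n)
    (sym (+-assoc (6 * N 7 [ 1 ] (suc n)) (N 7 [ 1 ] n) (5 * N 7 [ 1 ] n))))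

θ₈-recurrence : ∀ n → + θ 8 (n + 3) ≡ ((+ 7) *ℤ (+ θ 8 (n + 2)) -ℤ (+ 2) *ℤ (+ θ 8 (n + 1))) -ℤ (+ 24) *ℤ (+ θ 8 n)
θ₈-recurrence n rewrite θ≡N[1] 8 (n + 3) | θ≡N[1] 8 (n + 2) | θ≡N[1] 8 (n + 1) | θ≡N[1] 8 n
                      | +-comm n 3 | +-comm n 2 | +-comm n 1 =
  x+2y+24w≡7z⇒x≡7z-2y-24w (N 8 [ 1 ] (3 + n)) (N 8 [ 1 ] (1 + n)) (N 8 [ 1 ] (2 + n)) (N 8 [ 1 ] n)
   (third-order-recurrence (N 8 [ 1 ]) (N 8 (1 ∷ 2 ∷ [])) (N 8 (1 ∷ 4 ∷ []))
    (transition-by-computation 8 [ 1 ]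
      ((1 , 1 ∷ 2 ∷ []) ∷ (2 , 1 ∷ 2 ∷ []) ∷ (3 , [ 1 ]) ∷ (5 , [ 1 ]) ∷ (6 , [ 1 ]) ∷ (7 , [ 1 ]) ∷ []) refl)
    (transition-by-computation 8 (1 ∷ 2 ∷ [])
      ((1 , 1 ∷ 4 ∷ []) ∷ (3 , 1 ∷ 2 ∷ []) ∷ (5 , [ 1 ]) ∷ (7 , [ 1 ]) ∷ (10 , [ 1 ]) ∷ (14 , [ 1 ]) ∷ []) refl)
    (transition-by-computation 8 (1 ∷ 4 ∷ [])
      ((1 , 1 ∷ 4 ∷ []) ∷ (2 , 1 ∷ 4 ∷ []) ∷ (3 , 1 ∷ 2 ∷ []) ∷
       (5 , 1 ∷ 2 ∷ []) ∷ (6 , 1 ∷ 2 ∷ []) ∷ (7 , 1 ∷ 2 ∷ []) ∷ []) refl)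
    n)

proposition2 : (∀ (k : ℕ) → 2 ≤ k → θ k 0 ≡ 1 × θ k 1 ≡ k)
    × (∀ (n : ℕ) → θ 2 (suc n) ≡ 2 * θ 2 n)
    × (∀ (n : ℕ) → θ 3 (suc n) ≡ 3 * θ 3 n)
    × (∀ (n : ℕ) → θ 4 (n + 2) ≡ 2 * θ 4 (n + 1) + 4 * θ 4 n)
    × (∀ (n : ℕ) → θ 5 (n + 2) ≡ 3 * θ 5 (n + 1) + 6 * θ 5 n)
    × (∀ (n : ℕ) → 1 ≤ n → θ 6 (n + 1) ≡ 5 * θ 6 n)
    × (∀ (n : ℕ) → θ 7 (n + 2) ≡ 6 * θ 7 (n + 1) + θ 7 n)
    × (θ 8 2 ≡ 48
      × (∀ (n : ℕ) → + θ 8 (n + 3) ≡ ((+ 7) *ℤ (+ θ 8 (n + 2)) -ℤ (+ 2) *ℤ (+ θ 8 (n + 1))) -ℤ (+ 24) *ℤ (+ θ 8 n)))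
proposition2 =
  (λ k _ → refl , θ-at-1 k) , θ₂-recurrence , θ₃-recurrence , θ₄-recurrence , θ₅-recurrence ,
  θ₆-recurrence , θ₇-recurrence , refl , θ₈-recurrence
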